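{- Let $n\ge 6$ be an integer with $n\equiv 2\pmod 4$, let $A=\{v\in V(C_n\square K_2): x_v+y_v\equiv 0\pmod 2\}$, $Q=\{\{v,w\}\subseteq A: d_{C_n}(x_v,x_w)=3\}$, and let $a=(\frac n2-2,1)$, $b=(\frac n2+1,2)$, $t=(n-2,2)$, $u=(1,1)$ and $S^*=\{(2i-1,1): i\in\{1,\dots,\frac{n-2}{4}\}\}$. Then for every $\{v,w\}\in Q\setminus\{\{a,b\},\{t,u\}\}$ there exists $s\in S^*$ such that $d(v,s)=d(w,s)$.
   Context: $C_n$ is the cycle with vertex set $[n]=\{1,\dots,n\}$, where $i$ is adjacent to $i+1$ for $1\le i<n$ and $n$ is adjacent to $1$; $K_2$ has vertex set $\{1,2\}$. The Cartesian product $C_n\square K_2$ has vertex set $[n]\times\{1,2\}$, with $(g,h)\sim(g',h')$ iff either $g=g'$ and $hh'$ is an edge of $K_2$, or $h=h'$ and $gg'\in E(C_n)$. A vertex $v$ is written $v=(x_v,y_v)$. $d$ denotes the shortest-path distance in $C_n\square K_2$. -}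

module Defs where

open import Data.Nat using (ℕ; zero; suc; _+_; _*_; _∸_; _≤_)
open import Data.Nat.DivMod using (_/_; _%_)
open import Data.Product using (_×_; _,_; Σ; ∃; proj₁; proj₂)
open import Data.Sum using (_⊎_)
open import Relation.Binary.PropositionalEquality using (_≡_)
open import Relation.Nullary using (¬_)
open import Level using (0ℓ)

data Walk {V : Set} (E : V → V → Set) : V → V → ℕ → Set where
  nil  : ∀ {v} → Walk E v v 0
  step : ∀ {u v w k} → E u v → Walk E v w k → Walk E u w (suc k)

IsDist : {V : Set} → (V → V → Set) → V → V → ℕ → Set
IsDist E v w k = Walk E v w k × (∀ m → Walk E v w m → k ≤ m)

InCn : ℕ → ℕ → Set
InCn n i = 1 ≤ i × i ≤ n

CnAdj : ℕ → ℕ → ℕ → Set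
CnAdj n i j = InCn n i × InCn n j ×
  ((j ≡ suc i) ⊎ (i ≡ suc j) ⊎ (i ≡ n × j ≡ 1) ⊎ (i ≡ 1 × j ≡ n))

InK2 : ℕ → Set
InK2 h = (h ≡ 1) ⊎ (h ≡ 2)

K2Adj : ℕ → ℕ → Set
K2Adj h h' = (h ≡ 1 × h' ≡ 2) ⊎ (h ≡ 2 × h' ≡ 1)

Vtx : Set
Vtx = ℕ × ℕ

InV : ℕ → Vtx → Set
InV n (x , y) = InCn n x × InK2 y

PAdj : ℕ → Vtx → Vtx → Set
PAdj n (g , h) (g' , h') =
  (g ≡ g' × InCn n g × K2Adj h h') ⊎ (h ≡ h' × InK2 h × CnAdj n g g')

IsDistCn : ℕ → ℕ → ℕ → ℕ → Set
IsDistCn n = IsDist (CnAdj n)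

IsDistP : ℕ → Vtx → Vtx → ℕ → Set
IsDistP n = IsDist (PAdj n)

InA : ℕ → Vtx → Set
InA n v = InV n v × (proj₁ v + proj₂ v) % 2 ≡ 0

InQ : ℕ → Vtx → Vtx → Set
InQ n v w = InA n v × InA n w × IsDistCn n (proj₁ v) (proj₁ w) 3

InSstar : ℕ → Vtx → Set
InSstar n s = ∃ λ i → 1 ≤ i × i ≤ (n ∸ 2) / 4 × s ≡ (2 * i ∸ 1 , 1)

SamePair : Vtx → Vtx → Vtx → Vtx → Set
SamePair v w p q = (v ≡ p × w ≡ q) ⊎ (v ≡ q × w ≡ p)

-- Distances in C_n □ K_2 are |y − y'| + d(x , x'), where d(x , x') = min (|x − x'|, n − |x − x'|):
-- a walk of this length exists, and the quantity drops by at most one along each edge.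
-- Write n = 4 (m + 1) + 2. As n is even, a pair in Q joins an odd position x on layer 1 to an even
-- position z on layer 2 with z ≡ x ± 3 (mod n), and (σ , 1) is equidistant from the two vertices iff
-- d(x , σ) = d(z , σ) + 1. For z ≡ x + 3 this holds for σ ≡ x + 2 and for σ ≡ x − 2 (m + 1); for
-- z ≡ x − 3 it holds for σ ≡ x − 2 and for σ ≡ x + 2 (m + 1). One of the two candidates is an odd
-- position in {1, …, 2m + 1}, i.e. lies in S*, unless the pair is {a , b} or {t , u}.

module Submission where

open import Defs
open import Data.Nat using (ℕ; zero; suc; _+_; _*_; _∸_; _≤_; _<_; _⊓_; z≤n; s≤s; s≤s⁻¹; ∣_-_∣)
open import Data.Nat.Properties
open import Data.Nat.DivMod using (_/_; _%_; m≡m%n+[m/n]*n; m*n/n≡m)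
open import Data.Nat.Divisibility using (divides; m%n≡0⇒n∣m)
open import Data.Nat.Tactic.RingSolver using (solve)
open import Data.List using (_∷_; [])
open import Data.Product using (_×_; _,_; ∃; proj₁; proj₂)
import Data.Product as Product
open import Data.Sum using (_⊎_; inj₁; inj₂)
import Data.Sum as Sum
open import Data.Empty using (⊥-elim)
open import Relation.Binary using (tri<; tri≈; tri>)
open import Relation.Binary.PropositionalEquality
open import Relation.Nullary using (¬_)

module _ {V : Set} {E : V → V → Set} where

  _++ʷ_ : ∀ {u v w k l} → Walk E u v k → Walk E v w l → Walk E u w (k + l)
  nil      ++ʷ q = q
  step e p ++ʷ q = step e (p ++ʷ q)

  reverseʷ : (∀ {u v} → E u v → E v u) → ∀ {u v k} → Walk E u v k → Walk E v u k
  reverseʷ E-sym nil = nil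
  reverseʷ E-sym {k = suc k} (step e p) =
    subst (Walk E _ _) (+-comm k 1) (reverseʷ E-sym p ++ʷ step (E-sym e) nil)

  module _ (δ : V → ℕ) (δ-lipschitz : ∀ {u v} → E u v → δ u ≤ suc (δ v)) where

    potential≤length : ∀ {u w k} → Walk E u w k → δ u ≤ k + δ w
    potential≤length nil        = ≤-refl
    potential≤length (step e p) = ≤-trans (δ-lipschitz e) (s≤s (potential≤length p))

    isDist-byPotential : ∀ {v w} → δ w ≡ 0 → Walk E v w (δ v) → IsDist E v w (δ v)
    isDist-byPotential {v} δw≡0 p = p , λ k q →
      subst (δ v ≤_) (trans (cong (k +_) δw≡0) (+-identityʳ k)) (potential≤length q)

  isDist-unique : ∀ {v w k l} → IsDist E v w k → IsDist E v w l → k ≡ l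
  isDist-unique (p , p-min) (q , q-min) = ≤-antisym (p-min _ q) (q-min _ p)

mapʷ : {V W : Set} {E : V → V → Set} {F : W → W → Set} (h : V → W) →
       (∀ {u v} → E u v → F (h u) (h v)) → ∀ {u v k} → Walk E u v k → Walk F (h u) (h v) k
mapʷ h hom nil        = nil
mapʷ h hom (step e p) = step (hom e) (mapʷ h hom p)

shorterArc : ℕ → ℕ → ℕ
shorterArc n d = d ⊓ (n ∸ d)

shorterArc-flip : ∀ {n d} → d ≤ n → shorterArc n (n ∸ d) ≡ shorterArc n d
shorterArc-flip {n} {d} d≤n = trans (cong ((n ∸ d) ⊓_) (m∸[m∸n]≡n d≤n)) (⊓-comm (n ∸ d) d)

shorterArc-short : ∀ {n d} → d + d ≤ n → shorterArc n d ≡ d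
shorterArc-short {n} {d} 2d≤n =
  m≤n⇒m⊓n≡m (subst (_≤ n ∸ d) (m+n∸n≡m d d) (∸-monoˡ-≤ d 2d≤n))

∸-lipschitz : ∀ n {d e} → e ≤ suc d → n ∸ d ≤ suc (n ∸ e)
∸-lipschitz n {d} {e} e≤1+d = m≤n+o⇒m∸n≤o n d (begin
  n                ≤⟨ m≤n+m∸n n e ⟩
  e + (n ∸ e)      ≤⟨ +-monoˡ-≤ (n ∸ e) e≤1+d ⟩
  suc d + (n ∸ e)  ≡⟨ sym (+-suc d (n ∸ e)) ⟩
  d + suc (n ∸ e)  ∎)
  where open ≤-Reasoning

shorterArc-lipschitz : ∀ n {d e} → d ≤ suc e → e ≤ suc d → shorterArc n d ≤ suc (shorterArc n e)
shorterArc-lipschitz n d≤1+e e≤1+d = ⊓-mono-≤ d≤1+e (∸-lipschitz n e≤1+d)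

∣-∣-adjacent : ∀ m n → ∣ m - n ∣ ≤ suc ∣ suc m - n ∣ × ∣ suc m - n ∣ ≤ suc ∣ m - n ∣
∣-∣-adjacent zero    zero    = z≤n , ≤-refl
∣-∣-adjacent zero    (suc n) = ≤-refl , m≤n⇒m≤1+n (n≤1+n n)
∣-∣-adjacent (suc m) zero    = m≤n⇒m≤1+n (n≤1+n (suc m)) , ≤-refl
∣-∣-adjacent (suc m) (suc n) = ∣-∣-adjacent m n

cycleDist : ℕ → ℕ → ℕ → ℕ
cycleDist n x y = shorterArc n ∣ x - y ∣

cycleDist-sym : ∀ n x y → cycleDist n x y ≡ cycleDist n y x
cycleDist-sym n x y = cong (shorterArc n) (∣-∣-comm x y)

cycleDist-self : ∀ n x → cycleDist n x x ≡ 0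
cycleDist-self n x = cong (shorterArc n) (∣n-n∣≡0 x)

cycleDist-from-last : ∀ {n t} → t ≤ n → cycleDist n n t ≡ shorterArc n t
cycleDist-from-last {n} t≤n =
  trans (cong (shorterArc n) (m≤n⇒∣n-m∣≡n∸m t≤n)) (shorterArc-flip t≤n)

cycleDist-lipschitz : ∀ {n t a b} → InCn n t → CnAdj n a b → cycleDist n a t ≤ suc (cycleDist n b t)
cycleDist-lipschitz {n} {t} {a} _ (_ , _ , inj₁ refl) =
  shorterArc-lipschitz n (proj₁ (∣-∣-adjacent a t)) (proj₂ (∣-∣-adjacent a t))
cycleDist-lipschitz {n} {t} {b = b} _ (_ , _ , inj₂ (inj₁ refl)) =
  shorterArc-lipschitz n (proj₂ (∣-∣-adjacent b t)) (proj₁ (∣-∣-adjacent b t))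
cycleDist-lipschitz {n} {suc t} (_ , t≤n) (_ , _ , inj₂ (inj₂ (inj₁ (refl , refl))))
  rewrite cycleDist-from-last t≤n = shorterArc-lipschitz n ≤-refl (m≤n⇒m≤1+n (n≤1+n t))
cycleDist-lipschitz {n} {suc t} (_ , t≤n) (_ , _ , inj₂ (inj₂ (inj₂ (refl , refl))))
  rewrite cycleDist-from-last t≤n = shorterArc-lipschitz n (m≤n⇒m≤1+n (n≤1+n t)) ≤-refl

m+n≡o⇒m≤o : ∀ {m o} n → m + n ≡ o → m ≤ o
m+n≡o⇒m≤o {m} n refl = m≤m+n m n

o+2*m≤o+2*n⇒m≤n : ∀ o {m n} → o + 2 * m ≤ o + 2 * n → m ≤ n
o+2*m≤o+2*n⇒m≤n o le = *-cancelˡ-≤ 2 (+-cancelˡ-≤ o _ _ le)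

m+n≡o+p∧m≤p⇒o≤n : ∀ {m n o p} → m + n ≡ o + p → m ≤ p → o ≤ n
m+n≡o+p∧m≤p⇒o≤n {m} {n} {o} {p} m+n≡o+p m≤p = +-cancelʳ-≤ m o n (begin
  o + m  ≤⟨ +-monoʳ-≤ o m≤p ⟩
  o + p  ≡⟨ sym m+n≡o+p ⟩
  m + n  ≡⟨ +-comm m n ⟩
  n + m  ∎)
  where open ≤-Reasoning

Clockwise : ℕ → ℕ → ℕ → ℕ → Set
Clockwise n a d b = a + d ≡ b ⊎ a + d ≡ b + n

Apart : ℕ → ℕ → ℕ → ℕ → Set
Apart n d a b = Clockwise n a d b ⊎ Clockwise n b d a

cycleDist-clockwise : ∀ {n a d b} → Clockwise n a d b → d + d ≤ n → cycleDist n a b ≡ d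
cycleDist-clockwise {n} {a} {d} (inj₁ refl) 2d≤n =
  trans (cong (shorterArc n) (∣m-m+n∣≡n a d)) (shorterArc-short 2d≤n)
cycleDist-clockwise {n} {a} {d} {b} (inj₂ a+d≡b+n) 2d≤n = begin
  shorterArc n ∣ a - b ∣              ≡⟨ cong (shorterArc n) ∣a-b∣≡n∸d ⟩
  shorterArc n (n ∸ d)                ≡⟨ shorterArc-flip d≤n ⟩
  shorterArc n d                      ≡⟨ shorterArc-short 2d≤n ⟩
  d                                   ∎
  where
  open ≡-Reasoning
  d≤n : d ≤ n
  d≤n = m+n≤o⇒m≤o d 2d≤n
  ∣a-b∣≡n∸d : ∣ a - b ∣ ≡ n ∸ d
  ∣a-b∣≡n∸d = begin
    ∣ a - b ∣             ≡⟨ sym (∣m+n-m+o∣≡∣n-o∣ d a b) ⟩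
    ∣ d + a - d + b ∣     ≡⟨ cong₂ ∣_-_∣ (trans (+-comm d a) a+d≡b+n) (+-comm d b) ⟩
    ∣ b + n - b + d ∣     ≡⟨ ∣m+n-m+o∣≡∣n-o∣ b n d ⟩
    ∣ n - d ∣             ≡⟨ m≤n⇒∣n-m∣≡n∸m d≤n ⟩
    n ∸ d                 ∎

cycleDist-apart : ∀ {n a d b} → Apart n d a b → d + d ≤ n → cycleDist n a b ≡ d
cycleDist-apart (inj₁ a→b) 2d≤n = cycleDist-clockwise a→b 2d≤n
cycleDist-apart {n} {a} {b = b} (inj₂ b→a) 2d≤n =
  trans (cycleDist-sym n a b) (cycleDist-clockwise b→a 2d≤n)

m+∣m-n∣≡n⊎n+∣m-n∣≡m : ∀ m n → m + ∣ m - n ∣ ≡ n ⊎ n + ∣ m - n ∣ ≡ m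
m+∣m-n∣≡n⊎n+∣m-n∣≡m zero    n       = inj₁ refl
m+∣m-n∣≡n⊎n+∣m-n∣≡m (suc m) zero    = inj₂ refl
m+∣m-n∣≡n⊎n+∣m-n∣≡m (suc m) (suc n) =
  Sum.map (cong suc) (cong suc) (m+∣m-n∣≡n⊎n+∣m-n∣≡m m n)

clockwise-complement : ∀ {n a d b} → a + d ≡ b → d ≤ n → Clockwise n b (n ∸ d) a
clockwise-complement {n} {a} {d} refl d≤n = inj₂ (begin
  a + d + (n ∸ d)    ≡⟨ +-assoc a d (n ∸ d) ⟩
  a + (d + (n ∸ d))  ≡⟨ cong (a +_) (m+[n∸m]≡n d≤n) ⟩
  a + n              ∎)
  where open ≡-Reasoning

apart-cycleDist : ∀ {n a b} → a ≤ n → b ≤ n → Apart n (cycleDist n a b) a b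
apart-cycleDist {n} {a} {b} a≤n b≤n with ⊓-sel ∣ a - b ∣ (n ∸ ∣ a - b ∣)
... | inj₁ eq = subst (λ d → Apart n d a b) (sym eq)
                  (Sum.map inj₁ inj₁ (m+∣m-n∣≡n⊎n+∣m-n∣≡m a b))
... | inj₂ eq = subst (λ d → Apart n d a b) (sym eq)
                  (Sum.swap (Sum.map complement complement (m+∣m-n∣≡n⊎n+∣m-n∣≡m a b)))
  where
  complement : ∀ {c c'} → c + ∣ a - b ∣ ≡ c' → Clockwise n c' (n ∸ ∣ a - b ∣) c
  complement e = clockwise-complement e (≤-trans (∣m-n∣≤m⊔n a b) (⊔-lub a≤n b≤n))

CnAdj-sym : ∀ {n a b} → CnAdj n a b → CnAdj n b a
CnAdj-sym (a∈ , b∈ , inj₁ eq)                = b∈ , a∈ , inj₂ (inj₁ eq)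
CnAdj-sym (a∈ , b∈ , inj₂ (inj₁ eq))         = b∈ , a∈ , inj₁ eq
CnAdj-sym (a∈ , b∈ , inj₂ (inj₂ (inj₁ eqs))) = b∈ , a∈ , inj₂ (inj₂ (inj₂ (Product.swap eqs)))
CnAdj-sym (a∈ , b∈ , inj₂ (inj₂ (inj₂ eqs))) = b∈ , a∈ , inj₂ (inj₂ (inj₁ (Product.swap eqs)))

clockwise-step : ∀ {n a d b} → Clockwise n a (suc d) b → Clockwise n (suc a) d b
clockwise-step {a = a} {d} = Sum.map (trans (sym (+-suc a d))) (trans (sym (+-suc a d)))

clockwise-step-wrap : ∀ {n d b} → b ≤ n → Clockwise n n (suc d) b → Clockwise n 1 d b
clockwise-step-wrap {n} b≤n (inj₁ n+1+d≡b) = ⊥-elim (m+1+n≰m n (subst (_≤ n) (sym n+1+d≡b) b≤n))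
clockwise-step-wrap {n} {b = b} _ (inj₂ n+1+d≡b+n) =
  inj₁ (+-cancelˡ-≡ n _ _ (trans n+1+d≡b+n (+-comm b n)))

clockwiseWalk : ∀ {n} d {a b} → InCn n a → InCn n b → Clockwise n a d b → Walk (CnAdj n) a b d
clockwiseWalk {n} zero {a} _ _ (inj₁ a+0≡b) =
  subst (λ c → Walk (CnAdj n) a c 0) (trans (sym (+-identityʳ a)) a+0≡b) nil
clockwiseWalk zero (_ , a≤n) (1≤b , _) (inj₂ a+0≡b+n) =
  ⊥-elim (1+n≰n (≤-trans 1≤b (m+n≡o+p∧m≤p⇒o≤n a+0≡b+n a≤n)))
clockwiseWalk (suc d) a∈@(1≤a , a≤n) b∈@(_ , b≤n) a→b with m≤n⇒m<n∨m≡n a≤n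
... | inj₁ a<n = step (a∈ , (s≤s z≤n , a<n) , inj₁ refl)
                      (clockwiseWalk d (s≤s z≤n , a<n) b∈ (clockwise-step a→b))
... | inj₂ refl = step (a∈ , (≤-refl , 1≤a) , inj₂ (inj₂ (inj₁ (refl , refl))))
                      (clockwiseWalk d (≤-refl , 1≤a) b∈ (clockwise-step-wrap b≤n a→b))

cycleWalk : ∀ {n a b} → InCn n a → InCn n b → Walk (CnAdj n) a b (cycleDist n a b)
cycleWalk a∈ b∈ with apart-cycleDist (proj₂ a∈) (proj₂ b∈)
... | inj₁ a→b = clockwiseWalk _ a∈ b∈ a→b
... | inj₂ b→a = reverseʷ CnAdj-sym (clockwiseWalk _ b∈ a∈ b→a)

cycleDist-isDist : ∀ {n a b} → InCn n a → InCn n b → IsDistCn n a b (cycleDist n a b)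
cycleDist-isDist {n} {b = b} a∈ b∈ =
  isDist-byPotential (λ c → cycleDist n c b) (cycleDist-lipschitz b∈) (cycleDist-self n b)
    (cycleWalk a∈ b∈)

prodDist : ℕ → Vtx → Vtx → ℕ
prodDist n (x , y) (x' , y') = ∣ y - y' ∣ + cycleDist n x x'

prodDist-lipschitz : ∀ {n t u v} → InV n t → PAdj n u v → prodDist n u t ≤ suc (prodDist n v t)
prodDist-lipschitz (_ , inj₁ refl) (inj₁ (refl , _ , inj₁ (refl , refl))) = m≤n⇒m≤1+n (n≤1+n _)
prodDist-lipschitz (_ , inj₂ refl) (inj₁ (refl , _ , inj₁ (refl , refl))) = ≤-refl
prodDist-lipschitz (_ , inj₁ refl) (inj₁ (refl , _ , inj₂ (refl , refl))) = ≤-refl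
prodDist-lipschitz (_ , inj₂ refl) (inj₁ (refl , _ , inj₂ (refl , refl))) = m≤n⇒m≤1+n (n≤1+n _)
prodDist-lipschitz {n} {tx , ty} {x , y} {x' , _} (tx∈ , _) (inj₂ (refl , _ , e)) =
  subst (∣ y - ty ∣ + cycleDist n x tx ≤_) (+-suc ∣ y - ty ∣ (cycleDist n x' tx))
        (+-monoʳ-≤ ∣ y - ty ∣ (cycleDist-lipschitz tx∈ e))

layerWalk : ∀ {n x x' y k} → InK2 y → Walk (CnAdj n) x x' k → Walk (PAdj n) (x , y) (x' , y) k
layerWalk y∈ = mapʷ (_, _) (λ e → inj₂ (refl , y∈ , e))

prodWalk : ∀ {n u v} → InV n u → InV n v → Walk (PAdj n) u v (prodDist n u v)
prodWalk (x∈ , inj₁ refl) (x'∈ , inj₁ refl) = layerWalk (inj₁ refl) (cycleWalk x∈ x'∈)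
prodWalk (x∈ , inj₂ refl) (x'∈ , inj₂ refl) = layerWalk (inj₂ refl) (cycleWalk x∈ x'∈)
prodWalk (x∈ , inj₁ refl) (x'∈ , inj₂ refl) =
  step (inj₁ (refl , x∈ , inj₁ (refl , refl))) (layerWalk (inj₂ refl) (cycleWalk x∈ x'∈))
prodWalk (x∈ , inj₂ refl) (x'∈ , inj₁ refl) =
  step (inj₁ (refl , x∈ , inj₂ (refl , refl))) (layerWalk (inj₁ refl) (cycleWalk x∈ x'∈))

prodDist-isDist : ∀ {n u v} → InV n u → InV n v → IsDistP n u v (prodDist n u v)
prodDist-isDist {n} {v = x , y} u∈ v∈ =
  isDist-byPotential (λ w → prodDist n w (x , y)) (prodDist-lipschitz v∈)
    (cong₂ _+_ (∣n-n∣≡0 y) (cycleDist-self n x)) (prodWalk u∈ v∈)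

-- With n = 4 (m + 1) + 2, the vertices (1 + 2 j , 1) with j ≤ m are exactly S*.
record EquidistantOnCycle (m x z : ℕ) : Set where
  constructor mkEquidistant
  field
    j     : ℕ
    j≤m   : j ≤ m
    equal : cycleDist (2 + 4 * suc m) x (1 + 2 * j) ≡ suc (cycleDist (2 + 4 * suc m) z (1 + 2 * j))

equidistant-at : ∀ {m x z} j d → j ≤ m →
  Apart (2 + 4 * suc m) (suc d) x (1 + 2 * j) → Apart (2 + 4 * suc m) d z (1 + 2 * j) →
  suc d + suc d ≤ 2 + 4 * suc m → EquidistantOnCycle m x z
equidistant-at j d j≤m x~σ z~σ bound = mkEquidistant j j≤m (trans (cycleDist-apart x~σ bound)
  (cong suc (sym (cycleDist-apart z~σ (≤-trans (+-mono-≤ (n≤1+n d) (n≤1+n d)) bound)))))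

short-arcs-fit : ∀ m → 2 + 2 ≤ 2 + 4 * suc m
short-arcs-fit m = m+n≡o⇒m≤o {2 + 2} {2 + 4 * suc m} (2 + 4 * m) (solve (m ∷ []))

long-arcs-fit : ∀ m → suc (1 + 2 * m) + suc (1 + 2 * m) ≤ 2 + 4 * suc m
long-arcs-fit m = m+n≡o⇒m≤o {suc (1 + 2 * m) + suc (1 + 2 * m)} {2 + 4 * suc m} 2 (solve (m ∷ []))

equidistant-forward-near : ∀ {m p} → p < m → EquidistantOnCycle m (1 + 2 * p) (1 + 2 * p + 3)
equidistant-forward-near {m} {p} p<m =
  equidistant-at (suc p) 1 p<m (inj₁ (inj₁ x→σ)) (inj₂ (inj₁ σ→z)) (short-arcs-fit m)
  where
  x→σ : 1 + 2 * p + 2 ≡ 1 + 2 * suc p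
  x→σ = solve (p ∷ [])
  σ→z : 1 + 2 * suc p + 1 ≡ 1 + 2 * p + 3
  σ→z = solve (p ∷ [])

equidistant-forward-far : ∀ m k → 1 + 2 * (suc m + k) + 3 ≤ 2 + 4 * suc m →
  EquidistantOnCycle m (1 + 2 * (suc m + k)) (1 + 2 * (suc m + k) + 3)
equidistant-forward-far m k z-bound =
  equidistant-at k (1 + 2 * m) k≤m (inj₂ (inj₁ σ→x)) (inj₁ (inj₂ z→σ)) (long-arcs-fit m)
  where
  σ→x : 1 + 2 * k + (2 + 2 * m) ≡ 1 + 2 * (suc m + k)
  σ→x = solve (m ∷ k ∷ [])
  z→σ : 1 + 2 * (suc m + k) + 3 + (1 + 2 * m) ≡ 1 + 2 * k + (2 + 4 * suc m)
  z→σ = solve (m ∷ k ∷ [])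
  k≤m : k ≤ m
  k≤m = o+2*m≤o+2*n⇒m≤n (6 + 2 * m) (begin
    6 + 2 * m + 2 * k          ≡⟨ solve (m ∷ k ∷ []) ⟩
    1 + 2 * (suc m + k) + 3    ≤⟨ z-bound ⟩
    2 + 4 * suc m              ≡⟨ solve (m ∷ []) ⟩
    6 + 2 * m + 2 * m          ∎)
    where open ≤-Reasoning

equidistant-backward-near : ∀ {m q} → q < m → EquidistantOnCycle m (2 + 2 * q + 3) (2 + 2 * q)
equidistant-backward-near {m} {q} q<m =
  equidistant-at (suc q) 1 q<m (inj₂ (inj₁ σ→x)) (inj₁ (inj₁ z→σ)) (short-arcs-fit m)
  where
  σ→x : 1 + 2 * suc q + 2 ≡ 2 + 2 * q + 3
  σ→x = solve (q ∷ [])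
  z→σ : 2 + 2 * q + 1 ≡ 1 + 2 * suc q
  z→σ = solve (q ∷ [])

equidistant-backward-far : ∀ m k → 2 + 2 * (m + k) + 3 ≤ 2 + 4 * suc m →
  EquidistantOnCycle m (2 + 2 * (m + k) + 3) (2 + 2 * (m + k))
equidistant-backward-far m k x-bound =
  equidistant-at k (1 + 2 * m) k≤m (inj₁ (inj₂ x→σ)) (inj₂ (inj₁ σ→z)) (long-arcs-fit m)
  where
  x→σ : 2 + 2 * (m + k) + 3 + (2 + 2 * m) ≡ 1 + 2 * k + (2 + 4 * suc m)
  x→σ = solve (m ∷ k ∷ [])
  σ→z : 1 + 2 * k + (1 + 2 * m) ≡ 2 + 2 * (m + k)
  σ→z = solve (m ∷ k ∷ [])
  k≤m : k ≤ m
  k≤m = s≤s⁻¹ (*-cancelˡ-< 2 k (suc m) (+-cancelˡ-≤ (4 + 2 * m) _ _ (begin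
    4 + 2 * m + suc (2 * k)    ≡⟨ solve (m ∷ k ∷ []) ⟩
    2 + 2 * (m + k) + 3        ≤⟨ x-bound ⟩
    2 + 4 * suc m              ≡⟨ solve (m ∷ []) ⟩
    4 + 2 * m + 2 * suc m      ∎)))
    where open ≤-Reasoning

equidistant-forward-wrap : ∀ m {x} → x + 3 ≡ 2 + (2 + 4 * suc m) → EquidistantOnCycle m x 2
equidistant-forward-wrap m {x} x+3≡z+n =
  equidistant-at 0 1 z≤n (inj₁ (inj₂ x→σ)) (inj₂ (inj₁ σ→z)) (short-arcs-fit m)
  where
  x→σ : x + 2 ≡ 1 + (2 + 4 * suc m)
  x→σ = +-cancelʳ-≡ 1 _ _ (begin
    x + 2 + 1                  ≡⟨ +-assoc x 2 1 ⟩
    x + 3                      ≡⟨ x+3≡z+n ⟩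
    2 + (2 + 4 * suc m)        ≡⟨ solve (m ∷ []) ⟩
    1 + (2 + 4 * suc m) + 1    ∎)
    where open ≡-Reasoning
  σ→z : 1 + 1 ≡ 2
  σ→z = refl

equidistant-backward-wrap : ∀ m {z} → z + 3 ≡ 3 + (2 + 4 * suc m) → EquidistantOnCycle m 3 z
equidistant-backward-wrap m {z} z+3≡x+n =
  equidistant-at 0 1 z≤n (inj₂ (inj₁ σ→x)) (inj₁ (inj₂ z→σ)) (short-arcs-fit m)
  where
  σ→x : 1 + 2 ≡ 3
  σ→x = refl
  z→σ : z + 1 ≡ 1 + (2 + 4 * suc m)
  z→σ = +-cancelʳ-≡ 2 _ _ (begin
    z + 1 + 2                  ≡⟨ +-assoc z 1 2 ⟩
    z + 3                      ≡⟨ z+3≡x+n ⟩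
    3 + (2 + 4 * suc m)        ≡⟨ solve (m ∷ []) ⟩
    1 + (2 + 4 * suc m) + 2    ∎)
    where open ≡-Reasoning

odd≤3 : ∀ {x p} → x ≡ 1 + 2 * p → x ≤ 3 → x ≡ 1 ⊎ x ≡ 3
odd≤3 {p = zero}        refl _                     = inj₁ refl
odd≤3 {p = suc zero}    refl _                     = inj₂ refl
odd≤3 {p = suc (suc p)} refl (s≤s (s≤s (s≤s le))) = ⊥-elim (m+1+n≰m p (≤-trans le z≤n))

even≤3 : ∀ {z q} → z ≡ 2 + 2 * q → z ≤ 3 → z ≡ 2
even≤3 {q = zero}  refl _                     = refl
even≤3 {q = suc q} refl (s≤s (s≤s (s≤s le))) = ⊥-elim (m+1+n≰m q (≤-trans le z≤n))

equidistant-core : ∀ m {x z p q} → Apart (2 + 4 * suc m) 3 x z → x ≡ 1 + 2 * p → z ≡ 2 + 2 * q →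
  x ≤ 2 + 4 * suc m → z ≤ 2 + 4 * suc m →
  ¬ (x ≡ 1 + 2 * m × z ≡ 4 + 2 * m) → ¬ (x ≡ 1 × z ≡ 4 * suc m) → EquidistantOnCycle m x z
equidistant-core m {p = p} (inj₁ (inj₁ refl)) refl _ _ z-bound not-ab _ with <-cmp p m
... | tri< p<m _ _ = equidistant-forward-near p<m
... | tri≈ _ refl _ = ⊥-elim (not-ab (refl , solve (m ∷ [])))
... | tri> _ _ m<p with m≤n⇒∃[o]m+o≡n m<p
...   | k , refl = equidistant-forward-far m k z-bound
equidistant-core m {q = q} (inj₂ (inj₁ refl)) _ refl x-bound _ _ _ with <-≤-connex q m
... | inj₁ q<m = equidistant-backward-near q<m
... | inj₂ m≤q with m≤n⇒∃[o]m+o≡n m≤q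
...   | k , refl = equidistant-backward-far m k x-bound
equidistant-core m {q = q} (inj₁ (inj₂ x+3≡z+n)) _ z-even x-bound _ _ _
  with even≤3 {q = q} z-even (m+n≡o+p∧m≤p⇒o≤n x+3≡z+n x-bound)
... | refl = equidistant-forward-wrap m x+3≡z+n
equidistant-core m {z = z} {p} (inj₂ (inj₂ z+3≡x+n)) x-odd _ _ z-bound _ not-tu
  with odd≤3 {p = p} x-odd (m+n≡o+p∧m≤p⇒o≤n z+3≡x+n z-bound)
... | inj₁ refl = ⊥-elim (not-tu (refl , +-cancelʳ-≡ 3 z (4 * suc m) (begin
        z + 3                  ≡⟨ z+3≡x+n ⟩
        1 + (2 + 4 * suc m)    ≡⟨ solve (m ∷ []) ⟩
        4 * suc m + 3          ∎)))
  where open ≡-Reasoning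
... | inj₂ refl = equidistant-backward-wrap m z+3≡x+n

layer-parity : ∀ {x y} → InK2 y → 1 ≤ x → (x + y) % 2 ≡ 0 → ∃ λ p → x ≡ y + 2 * p
layer-parity {x} {y} y∈ 1≤x even with y∈ | m%n≡0⇒n∣m (x + y) 2 even
... | inj₁ refl | divides zero x+1≡0 = ⊥-elim (m+1+n≢0 x x+1≡0)
... | inj₁ refl | divides (suc p) x+1≡[1+p]*2 = p , +-cancelʳ-≡ 1 x (1 + 2 * p) (begin
  x + 1              ≡⟨ x+1≡[1+p]*2 ⟩
  suc p * 2          ≡⟨ solve (p ∷ []) ⟩
  1 + 2 * p + 1      ∎)
  where open ≡-Reasoning
... | inj₂ refl | divides zero x+2≡0 = ⊥-elim (m+1+n≢0 x x+2≡0)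
... | inj₂ refl | divides 1 x+2≡2 = ⊥-elim (1+n≰n (subst (1 ≤_) (+-cancelʳ-≡ 2 x 0 x+2≡2) 1≤x))
... | inj₂ refl | divides (suc (suc p)) x+2≡[2+p]*2 = p , +-cancelʳ-≡ 2 x (2 + 2 * p) (begin
  x + 2              ≡⟨ x+2≡[2+p]*2 ⟩
  suc (suc p) * 2    ≡⟨ solve (p ∷ []) ⟩
  2 + 2 * p + 2      ∎)
  where open ≡-Reasoning

cycleDist-sameParity : ∀ h c p q → cycleDist (2 * h) (c + 2 * p) (c + 2 * q) ≡ 2 * shorterArc h ∣ p - q ∣
cycleDist-sameParity h c p q = begin
  shorterArc (2 * h) ∣ c + 2 * p - c + 2 * q ∣
    ≡⟨ cong (shorterArc (2 * h)) (∣m+n-m+o∣≡∣n-o∣ c (2 * p) (2 * q)) ⟩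
  shorterArc (2 * h) ∣ 2 * p - 2 * q ∣
    ≡⟨ cong (shorterArc (2 * h)) (sym (*-distribˡ-∣-∣ 2 p q)) ⟩
  (2 * D) ⊓ (2 * h ∸ 2 * D)
    ≡⟨ cong ((2 * D) ⊓_) (sym (*-distribˡ-∸ 2 h D)) ⟩
  (2 * D) ⊓ (2 * (h ∸ D))
    ≡⟨ sym (*-distribˡ-⊓ 2 D (h ∸ D)) ⟩
  2 * shorterArc h D
    ∎
  where
  open ≡-Reasoning
  D = ∣ p - q ∣

HasEquidistantS* : ℕ → Vtx → Vtx → Set
HasEquidistantS* n v w = ∃ λ s → InSstar n s × ∃ λ k → IsDistP n v s k × IsDistP n w s k

HasEquidistantS*-sym : ∀ {n v w} → HasEquidistantS* n v w → HasEquidistantS* n w v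
HasEquidistantS*-sym (s , s∈S* , k , v-s , w-s) = s , s∈S* , k , w-s , v-s

S*-size : ∀ m → (2 + 4 * suc m ∸ 2) / 4 ≡ suc m
S*-size m = trans (cong (_/ 4) (*-comm 4 (suc m))) (m*n/n≡m (suc m) 4)

equidistantOnCycle⇒S* : ∀ m {x z} → InCn (2 + 4 * suc m) x → InCn (2 + 4 * suc m) z →
  EquidistantOnCycle m x z → HasEquidistantS* (2 + 4 * suc m) (x , 1) (z , 2)
equidistantOnCycle⇒S* m {x} {z} x∈ z∈ (mkEquidistant j j≤m equal) =
  σ , (suc j , s≤s z≤n , subst (suc j ≤_) (sym (S*-size m)) (s≤s j≤m) ,
       cong (_, 1) (sym (+-suc j (j + 0)))) ,
  cycleDist (2 + 4 * suc m) x (1 + 2 * j) , prodDist-isDist (x∈ , inj₁ refl) σ∈ ,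
  subst (IsDistP (2 + 4 * suc m) (z , 2) σ) (sym equal) (prodDist-isDist (z∈ , inj₂ refl) σ∈)
  where
  σ : Vtx
  σ = (1 + 2 * j , 1)
  σ∈ : InV (2 + 4 * suc m) σ
  σ∈ = (s≤s z≤n , ≤-trans (+-monoʳ-≤ 1 (*-monoʳ-≤ 2 j≤m))
                    (m+n≡o⇒m≤o {1 + 2 * m} {2 + 4 * suc m} (5 + 2 * m) (solve (m ∷ [])))) , inj₁ refl

half-size : ∀ m → (2 + 4 * suc m) / 2 ≡ 3 + 2 * m
half-size m = trans (cong (_/ 2) n≡[3+2m]*2) (m*n/n≡m (3 + 2 * m) 2)
  where
  n≡[3+2m]*2 : 2 + 4 * suc m ≡ (3 + 2 * m) * 2
  n≡[3+2m]*2 = solve (m ∷ [])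

crossLayer-equidistant : ∀ m {x z} → InCn (2 + 4 * suc m) x → InCn (2 + 4 * suc m) z →
  (x + 1) % 2 ≡ 0 → (z + 2) % 2 ≡ 0 → cycleDist (2 + 4 * suc m) x z ≡ 3 →
  ¬ (x ≡ (2 + 4 * suc m) / 2 ∸ 2 × z ≡ (2 + 4 * suc m) / 2 + 1) → ¬ (x ≡ 1 × z ≡ 4 * suc m) →
  HasEquidistantS* (2 + 4 * suc m) (x , 1) (z , 2)
crossLayer-equidistant m {x} {z} x∈ z∈ x-par z-par d≡3 not-ab not-tu
  with layer-parity (inj₁ refl) (proj₁ x∈) x-par | layer-parity (inj₂ refl) (proj₁ z∈) z-par
... | p , x-odd | q , z-even =
  equidistantOnCycle⇒S* m x∈ z∈
    (equidistant-core m {p = p} {q} x~z x-odd z-even (proj₂ x∈) (proj₂ z∈) not-ab′ not-tu)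
  where
  x~z : Apart (2 + 4 * suc m) 3 x z
  x~z = subst (λ d → Apart _ d x z) d≡3 (apart-cycleDist (proj₂ x∈) (proj₂ z∈))
  not-ab′ : ¬ (x ≡ 1 + 2 * m × z ≡ 4 + 2 * m)
  not-ab′ (x≡ , z≡) = not-ab (trans x≡ (cong (_∸ 2) (sym (half-size m))) , trans z≡ (begin
    4 + 2 * m                  ≡⟨ solve (m ∷ []) ⟩
    3 + 2 * m + 1              ≡⟨ cong (_+ 1) (sym (half-size m)) ⟩
    (2 + 4 * suc m) / 2 + 1    ∎))
    where open ≡-Reasoning

sameLayer-distance≢3 : ∀ m {x z y} → InK2 y → 1 ≤ x → 1 ≤ z →
  (x + y) % 2 ≡ 0 → (z + y) % 2 ≡ 0 → cycleDist (2 + 4 * suc m) x z ≢ 3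
sameLayer-distance≢3 m {y = y} y∈ 1≤x 1≤z x-par z-par
  with layer-parity y∈ 1≤x x-par | layer-parity y∈ 1≤z z-par
... | p , refl | q , refl = λ d≡3 → even≢odd (shorterArc h ∣ p - q ∣) 1 (begin
  2 * shorterArc h ∣ p - q ∣                        ≡⟨ sym (cycleDist-sameParity h y p q) ⟩
  cycleDist (2 * h) (y + 2 * p) (y + 2 * q)
    ≡⟨ cong (λ n → cycleDist n (y + 2 * p) (y + 2 * q)) 2h≡n ⟩
  cycleDist (2 + 4 * suc m) (y + 2 * p) (y + 2 * q) ≡⟨ d≡3 ⟩
  3                                                 ∎)
  where
  open ≡-Reasoning
  h = 1 + 2 * suc m
  2h≡n : 2 * (1 + 2 * suc m) ≡ 2 + 4 * suc m
  2h≡n = solve (m ∷ [])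

equidistant-pairs : ∀ m (v w : Vtx) → InQ (2 + 4 * suc m) v w →
  ¬ SamePair v w ((2 + 4 * suc m) / 2 ∸ 2 , 1) ((2 + 4 * suc m) / 2 + 1 , 2) →
  ¬ SamePair v w (2 + 4 * suc m ∸ 2 , 2) (1 , 1) → HasEquidistantS* (2 + 4 * suc m) v w
equidistant-pairs m (x , .1) (z , .2)
  (((x∈ , inj₁ refl) , x-par) , ((z∈ , inj₂ refl) , z-par) , x-z) not-ab not-tu =
  crossLayer-equidistant m x∈ z∈ x-par z-par (isDist-unique (cycleDist-isDist x∈ z∈) x-z)
    (λ (x≡a , z≡b) → not-ab (inj₁ (cong (_, 1) x≡a , cong (_, 2) z≡b)))
    (λ (x≡u , z≡t) → not-tu (inj₂ (cong (_, 1) x≡u , cong (_, 2) z≡t)))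
equidistant-pairs m (x , .2) (z , .1)
  (((x∈ , inj₂ refl) , x-par) , ((z∈ , inj₁ refl) , z-par) , x-z) not-ab not-tu =
  HasEquidistantS*-sym (crossLayer-equidistant m z∈ x∈ z-par x-par
    (trans (cycleDist-sym _ z x) (isDist-unique (cycleDist-isDist x∈ z∈) x-z))
    (λ (z≡a , x≡b) → not-ab (inj₂ (cong (_, 2) x≡b , cong (_, 1) z≡a)))
    (λ (z≡u , x≡t) → not-tu (inj₁ (cong (_, 2) x≡t , cong (_, 1) z≡u))))
equidistant-pairs m (x , .1) (z , .1)
  (((x∈ , inj₁ refl) , x-par) , ((z∈ , inj₁ refl) , z-par) , x-z) _ _ =
  ⊥-elim (sameLayer-distance≢3 m (inj₁ refl) (proj₁ x∈) (proj₁ z∈) x-par z-par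
    (isDist-unique (cycleDist-isDist x∈ z∈) x-z))
equidistant-pairs m (x , .2) (z , .2)
  (((x∈ , inj₂ refl) , x-par) , ((z∈ , inj₂ refl) , z-par) , x-z) _ _ =
  ⊥-elim (sameLayer-distance≢3 m (inj₂ refl) (proj₁ x∈) (proj₁ z∈) x-par z-par
    (isDist-unique (cycleDist-isDist x∈ z∈) x-z))

n%4≡2⇒n≡2+4*[1+m] : ∀ n → 6 ≤ n → n % 4 ≡ 2 → ∃ λ m → n ≡ 2 + 4 * suc m
n%4≡2⇒n≡2+4*[1+m] n 6≤n n%4≡2 with n / 4 | trans (m≡m%n+[m/n]*n n 4) (cong (_+ n / 4 * 4) n%4≡2)
... | zero  | n≡2         = ⊥-elim (m+1+n≰m 2 (subst (6 ≤_) n≡2 6≤n))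
... | suc m | n≡2+[1+m]*4 = m , trans n≡2+[1+m]*4 (cong (2 +_) (*-comm (suc m) 4))

mainTheorem17 : (n : ℕ) → 6 ≤ n → n % 4 ≡ 2 →
    (v w : Vtx) → InQ n v w →
    ¬ SamePair v w (n / 2 ∸ 2 , 1) (n / 2 + 1 , 2) →
    ¬ SamePair v w (n ∸ 2 , 2) (1 , 1) →
    ∃ λ s → InSstar n s × ∃ λ k → IsDistP n v s k × IsDistP n w s k
mainTheorem17 n 6≤n n%4≡2 with n%4≡2⇒n≡2+4*[1+m] n 6≤n n%4≡2
... | m , refl = equidistant-pairs m
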